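{- Let $n\in\mathbb{P}$ and $I,J\subseteq[n-1]$ with $I\cap J=\emptyset$, and let $w_0\in S_n$ be given by $w_0(i)=n+1-i$. Then $$\sum_{\sigma\in\mathcal{D}^I_J(S_n)}(-1)^{\ell(\sigma)}x^{L(\sigma)}=(-1)^{\ell(w_0)}x^{L(w_0)}\sum_{\sigma\in\mathcal{D}^J_I(S_n)}(-1)^{\ell(\sigma)}\left(\frac1x\right)^{L(\sigma)}.$$
   Context: $S_n$ is the symmetric group on $[n]$. For $\sigma\in S_n$: $\ell(\sigma)$ = number of pairs $i<j$ with $\sigma(i)>\sigma(j)$; $L(\sigma)$ = number of such pairs with $i\not\equiv j\pmod 2$; $D(\sigma)=\{i\in[n-1]:\sigma(i)>\sigma(i+1)\}$. For disjoint $I,J\subseteq[n-1]$, $\mathcal{D}^I_J(S_n)=\{\sigma\in S_n: J\subseteq D(\sigma)\subseteq[n-1]\setminus I\}$. -}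

module Defs where

open import Data.Bool.Base using (Bool; true; false; _∧_; _∨_; not; if_then_else_)
open import Data.Nat.Base using (ℕ; zero; suc; _<ᵇ_; _≡ᵇ_; _%_)
open import Data.Fin.Base using (Fin; zero; suc; toℕ; inject₁; opposite)
open import Data.Vec.Base using (Vec; []; _∷_; lookup; tabulate)
open import Data.List.Base using (List; []; _∷_; [_]; map; concatMap; filterᵇ; length; allFin; foldr)
open import Data.Rational.Base using (ℚ; 1ℚ; _*_; _+_; -_; 0ℚ)
open import Data.Fin.Subset using (Subset; inside; outside)

allB : ∀ {A : Set} → (A → Bool) → List A → Bool
allB p = foldr (λ a acc → p a ∧ acc) true

_^ℚ_ : ℚ → ℕ → ℚ
q ^ℚ zero  = 1ℚ
q ^ℚ suc k = q * (q ^ℚ k)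

-- A map [n] → [n] is represented (0-based) as a vector σ with σ(i) = lookup σ i.
-- All maps Fin n → Fin n (as vectors of length k over Fin n).
allMaps : (k n : ℕ) → List (Vec (Fin n) k)
allMaps zero    n = [ [] ]
allMaps (suc k) n = concatMap (λ v → map (λ a → a ∷ v) (allFin n)) (allMaps k n)

_==_ : ∀ {n} → Fin n → Fin n → Bool
a == b = toℕ a ≡ᵇ toℕ b

-- σ is injective (hence a permutation, since it maps Fin n to Fin n).
isPerm : ∀ {n} → Vec (Fin n) n → Bool
isPerm {n} σ = allB (λ i → allB (λ j → (i == j) ∨ not (lookup σ i == lookup σ j)) (allFin n)) (allFin n)

Sym : (n : ℕ) → List (Vec (Fin n) n)
Sym n = filterᵇ isPerm (allMaps n n)

countPairs : ∀ n → (Fin n → Fin n → Bool) → ℕ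
countPairs n p = length (filterᵇ (λ ij → p (Data.Product.proj₁ ij) (Data.Product.proj₂ ij))
                                 (concatMap (λ i → map (λ j → (i Data.Product., j)) (allFin n)) (allFin n)))
  where import Data.Product

invPair : ∀ {n} → Vec (Fin n) n → Fin n → Fin n → Bool
invPair σ i j = (toℕ i <ᵇ toℕ j) ∧ (toℕ (lookup σ j) <ᵇ toℕ (lookup σ i))

ℓ : ∀ {n} → Vec (Fin n) n → ℕ
ℓ {n} σ = countPairs n (invPair σ)

-- L(σ): number of inversions (i,j) with i ≢ j (mod 2).
-- (Parity of 0-based and 1-based indices differ by the same shift, so this is the same condition.)
L : ∀ {n} → Vec (Fin n) n → ℕ
L {n} σ = countPairs n (λ i j → invPair σ i j ∧ not ((toℕ i % 2) ≡ᵇ (toℕ j % 2)))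

-- Descents for σ ∈ S_(m+1): the element i : Fin m encodes the position i+1 ∈ [n-1]
-- (1-based), i.e. σ(i+1) > σ(i+2) in 1-based terms.
isDescent : ∀ {m} → Vec (Fin (suc m)) (suc m) → Fin m → Bool
isDescent σ i = toℕ (lookup σ (suc i)) <ᵇ toℕ (lookup σ (inject₁ i))

mem : ∀ {m} → Fin m → Subset m → Bool
mem i S = lookup S i

-- σ ∈ D^I_J(S_n)  ⇔  J ⊆ D(σ) ⊆ [n-1] ∖ I.
inDIJ : ∀ {m} → Subset m → Subset m → Vec (Fin (suc m)) (suc m) → Bool
inDIJ {m} I J σ =
  allB (λ i → (not (mem i J) ∨ isDescent σ i) ∧ (not (mem i I) ∨ not (isDescent σ i))) (allFin m)

DIJ : ∀ m → Subset m → Subset m → List (Vec (Fin (suc m)) (suc m))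
DIJ m I J = filterᵇ (inDIJ I J) (Sym (suc m))

sumℚ : ∀ {A : Set} → (A → ℚ) → List A → ℚ
sumℚ f = foldr (λ a acc → f a + acc) 0ℚ

weight : ∀ {n} → ℚ → Vec (Fin n) n → ℚ
weight y σ = ((- 1ℚ) ^ℚ ℓ σ) * (y ^ℚ L σ)

sumD : ∀ m → Subset m → Subset m → ℚ → ℚ
sumD m I J y = sumℚ (weight y) (DIJ m I J)

w₀ : ∀ n → Vec (Fin n) n
w₀ n = tabulate opposite

module Submission where

-- Left multiplication by the longest element w₀, i.e. the map
-- σ ↦ w₀σ which replaces every value v by n+1-v ("complement"), is an involution
-- of S_n with three properties:
--   * it turns every descent into an ascent and vice versa, so it maps
--     𝒟^I_J(S_n) bijectively onto 𝒟^J_I(S_n);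
--   * for i < j exactly one of σ, w₀σ has an inversion at (i,j), hence
--     ℓ(w₀σ) + ℓ(σ) = ℓ(w₀) and, restricting to pairs of opposite parity,
--     L(w₀σ) + L(σ) = L(w₀);
--   * consequently (-1)^ℓ(σ) x^L(σ) = (-1)^ℓ(w₀) x^L(w₀) · (-1)^ℓ(w₀σ) (1/x)^L(w₀σ).

open import Defs
open import Data.Nat.Base using (ℕ; suc)
open import Data.Fin.Subset using (Subset; _∩_; ⊥)
open import Data.Rational.Base using (ℚ; NonZero; 1/_; _*_; -_; 1ℚ)
open import Relation.Binary.PropositionalEquality using (_≡_)

open import Data.Nat.Base as ℕ using (zero; _<_; _≤_; s≤s; _<ᵇ_; _≡ᵇ_; _%_)
import Data.Nat.Properties as ℕP
open import Data.Bool.Base using (Bool; true; false; _∧_; _∨_; not; if_then_else_; T)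
open import Data.Bool.Properties using (∧-identityʳ; ∧-zeroʳ; ∧-comm; not-involutive)
open import Data.Fin.Base using (Fin; zero; suc; toℕ; inject₁; opposite; fromℕ)
import Data.Fin.Properties as FinP
open import Data.Vec.Base as Vec using (Vec; []; _∷_; lookup)
import Data.Vec.Properties as VecP
open import Data.List.Base as List using (List; []; _∷_; filterᵇ; length; allFin; _++_; concatMap)
open import Data.Product using (_×_; _,_; proj₁; proj₂)
open import Data.Rational.Base using (_+_; 0ℚ)
import Data.Rational.Properties as ℚP
open import Data.Rational.Solver using (module +-*-Solver)
open import Algebra.Bundles using (CommutativeRing)
open import Algebra.Properties.CommutativeSemiring.Exp
  (CommutativeRing.commutativeSemiring ℚP.+-*-commutativeRing) using (_^_; ^-homo-*; ^-distrib-*)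
open import Relation.Binary.PropositionalEquality using (refl; sym; trans; cong; cong₂; subst; module ≡-Reasoning)

open ≡-Reasoning

<ᵇ-irrefl : ∀ a → (a <ᵇ a) ≡ false
<ᵇ-irrefl zero    = refl
<ᵇ-irrefl (suc a) = <ᵇ-irrefl a

≡ᵇ-refl : ∀ a → (a ≡ᵇ a) ≡ true
≡ᵇ-refl zero    = refl
≡ᵇ-refl (suc a) = ≡ᵇ-refl a

<⇒<ᵇ-true : ∀ {a b} → a < b → (a <ᵇ b) ≡ true
<⇒<ᵇ-true {zero}  {suc b} _       = refl
<⇒<ᵇ-true {suc a} {suc b} (s≤s p) = <⇒<ᵇ-true p

≤⇒<ᵇ-false : ∀ {a b} → b ≤ a → (a <ᵇ b) ≡ false
≤⇒<ᵇ-false {a}     {zero}  _       = refl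
≤⇒<ᵇ-false {suc a} {suc b} (s≤s p) = ≤⇒<ᵇ-false p

<⇒≡ᵇ-false : ∀ {a b} → a < b → (a ≡ᵇ b) ≡ false
<⇒≡ᵇ-false {zero}  {suc b} _       = refl
<⇒≡ᵇ-false {suc a} {suc b} (s≤s p) = <⇒≡ᵇ-false p

>⇒≡ᵇ-false : ∀ {a b} → a < b → (b ≡ᵇ a) ≡ false
>⇒≡ᵇ-false {zero}  {suc b} _       = refl
>⇒≡ᵇ-false {suc a} {suc b} (s≤s p) = >⇒≡ᵇ-false p

<ᵇ⇒≡ᵇ-false : ∀ a b → (a <ᵇ b) ≡ true → (b ≡ᵇ a) ≡ false
<ᵇ⇒≡ᵇ-false a b a<ᵇb = >⇒≡ᵇ-false (ℕP.<ᵇ⇒< a b (subst T (sym a<ᵇb) _))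

<ᵇ-flip : ∀ a b → (a ≡ᵇ b) ≡ false → (b <ᵇ a) ≡ not (a <ᵇ b)
<ᵇ-flip zero    zero    ()
<ᵇ-flip zero    (suc b) _  = refl
<ᵇ-flip (suc a) zero    _  = refl
<ᵇ-flip (suc a) (suc b) p  = <ᵇ-flip a b p

opposite-<ᵇ : ∀ {n} (a b : Fin n) → (toℕ (opposite a) <ᵇ toℕ (opposite b)) ≡ (toℕ b <ᵇ toℕ a)
opposite-<ᵇ {suc n} zero    zero    = <ᵇ-irrefl (toℕ (fromℕ n))
opposite-<ᵇ {suc n} zero    (suc b) rewrite FinP.toℕ-fromℕ n | FinP.toℕ-inject₁ (opposite b) =
  ≤⇒<ᵇ-false (ℕP.<⇒≤ (FinP.toℕ<n (opposite b)))
opposite-<ᵇ {suc n} (suc a) zero    rewrite FinP.toℕ-fromℕ n | FinP.toℕ-inject₁ (opposite a) =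
  <⇒<ᵇ-true (FinP.toℕ<n (opposite a))
opposite-<ᵇ {suc n} (suc a) (suc b) rewrite FinP.toℕ-inject₁ (opposite a) | FinP.toℕ-inject₁ (opposite b) =
  opposite-<ᵇ a b

opposite-== : ∀ {n} (a b : Fin n) → (opposite a == opposite b) ≡ (a == b)
opposite-== {suc n} zero    zero    = ≡ᵇ-refl (toℕ (fromℕ n))
opposite-== {suc n} zero    (suc b) rewrite FinP.toℕ-fromℕ n | FinP.toℕ-inject₁ (opposite b) =
  >⇒≡ᵇ-false (FinP.toℕ<n (opposite b))
opposite-== {suc n} (suc a) zero    rewrite FinP.toℕ-fromℕ n | FinP.toℕ-inject₁ (opposite a) =
  <⇒≡ᵇ-false (FinP.toℕ<n (opposite a))
opposite-== {suc n} (suc a) (suc b) rewrite FinP.toℕ-inject₁ (opposite a) | FinP.toℕ-inject₁ (opposite b) =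
  opposite-== a b

allB-cong : ∀ {A : Set} {p q : A → Bool} → (∀ a → p a ≡ q a) → (xs : List A) → allB p xs ≡ allB q xs
allB-cong p≗q []       = refl
allB-cong p≗q (x ∷ xs) = cong₂ _∧_ (p≗q x) (allB-cong p≗q xs)

∧-true : ∀ {a b} → (a ∧ b) ≡ true → (a ≡ true) × (b ≡ true)
∧-true {true} {true} _ = refl , refl

allB-tabulate : ∀ {A : Set} {n} (p : A → Bool) (f : Fin n → A) →
  allB p (List.tabulate f) ≡ true → ∀ i → p (f i) ≡ true
allB-tabulate {n = suc n} p f h zero    = proj₁ (∧-true h)
allB-tabulate {n = suc n} p f h (suc i) = allB-tabulate p (λ j → f (suc j)) (proj₂ (∧-true h)) i

perm-injective : ∀ {n} (σ : Vec (Fin n) n) → isPerm σ ≡ true →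
  ∀ i j → (i == j) ≡ false → (lookup σ i == lookup σ j) ≡ false
perm-injective σ isPermσ i j i≢j = trans (sym (not-involutive _)) (cong not values-differ)
  where
  values-differ : not (lookup σ i == lookup σ j) ≡ true
  values-differ = subst (λ b → (b ∨ not (lookup σ i == lookup σ j)) ≡ true) i≢j
    (allB-tabulate _ (λ k → k) (allB-tabulate _ (λ k → k) isPermσ i) j)

complement : ∀ {n k} → Vec (Fin n) k → Vec (Fin n) k
complement = Vec.map opposite

lookup-complement : ∀ {n} (σ : Vec (Fin n) n) i → lookup (complement σ) i ≡ opposite (lookup σ i)
lookup-complement σ i = VecP.lookup-map i opposite σ

lookup-w₀ : ∀ {n} (i : Fin n) → lookup (w₀ n) i ≡ opposite i
lookup-w₀ i = VecP.lookup∘tabulate opposite i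

isPerm-complement : ∀ {n} (σ : Vec (Fin n) n) → isPerm (complement σ) ≡ isPerm σ
isPerm-complement {n} σ = allB-cong (λ i → allB-cong (λ j →
  cong (λ b → (i == j) ∨ not b)
    (trans (cong₂ _==_ (lookup-complement σ i) (lookup-complement σ j))
           (opposite-== (lookup σ i) (lookup σ j)))) (allFin n)) (allFin n)

-- Complementation exchanges descents and ascents (positions i+1, i+2 differ, so
-- their values differ).
descent-complement : ∀ {m} (σ : Vec (Fin (suc m)) (suc m)) → isPerm σ ≡ true → ∀ i →
  isDescent (complement σ) i ≡ not (isDescent σ i)
descent-complement σ isPermσ i
  rewrite lookup-complement σ (suc i) | lookup-complement σ (inject₁ i)
        | opposite-<ᵇ (lookup σ (suc i)) (lookup σ (inject₁ i)) =
  <ᵇ-flip (toℕ (lookup σ (suc i))) (toℕ (lookup σ (inject₁ i)))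
    (perm-injective σ isPermσ (suc i) (inject₁ i) positions-differ)
  where
  positions-differ : (suc i == inject₁ i) ≡ false
  positions-differ rewrite FinP.toℕ-inject₁ i = >⇒≡ᵇ-false (ℕP.n<1+n (toℕ i))

inDIJ-complement : ∀ {m} (I J : Subset m) (σ : Vec (Fin (suc m)) (suc m)) → isPerm σ ≡ true →
  inDIJ J I (complement σ) ≡ inDIJ I J σ
inDIJ-complement {m} I J σ isPermσ = allB-cong condition-swap (allFin m)
  where
  condition-swap : ∀ i →
    ((not (mem i I) ∨ isDescent (complement σ) i) ∧ (not (mem i J) ∨ not (isDescent (complement σ) i)))
      ≡ ((not (mem i J) ∨ isDescent σ i) ∧ (not (mem i I) ∨ not (isDescent σ i)))
  condition-swap i rewrite descent-complement σ isPermσ i | not-involutive (isDescent σ i) =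
    ∧-comm (not (mem i I) ∨ not (isDescent σ i)) (not (mem i J) ∨ isDescent σ i)

ind : Bool → ℕ
ind true  = 1
ind false = 0

count-additive : ∀ {A : Set} (P Q R : A → Bool) → (∀ a → ind (P a) ℕ.+ ind (Q a) ≡ ind (R a)) →
  (xs : List A) → length (filterᵇ P xs) ℕ.+ length (filterᵇ Q xs) ≡ length (filterᵇ R xs)
count-additive P Q R h [] = refl
count-additive P Q R h (x ∷ xs) with P x | Q x | R x | h x | count-additive P Q R h xs
... | true  | false | true  | _ | ih = cong suc ih
... | false | true  | true  | _ | ih = trans (ℕP.+-suc _ _) (cong suc ih)
... | false | false | false | _ | ih = ih
... | true  | true  | true  | () | _
... | true  | true  | false | () | _
... | true  | false | false | () | _
... | false | true  | false | () | _
... | false | false | true  | () | _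

countPairs-additive : ∀ n (p q r : Fin n → Fin n → Bool) →
  (∀ i j → ind (p i j) ℕ.+ ind (q i j) ≡ ind (r i j)) →
  countPairs n p ℕ.+ countPairs n q ≡ countPairs n r
countPairs-additive n p q r h =
  count-additive (λ ij → p (proj₁ ij) (proj₂ ij)) (λ ij → q (proj₁ ij) (proj₂ ij))
                 (λ ij → r (proj₁ ij) (proj₂ ij)) (λ ij → h (proj₁ ij) (proj₂ ij))
                 (concatMap (λ i → List.map (λ j → (i , j)) (allFin n)) (allFin n))

ind-restrict : ∀ a b c d → ind a ℕ.+ ind b ≡ ind c → ind (a ∧ d) ℕ.+ ind (b ∧ d) ≡ ind (c ∧ d)
ind-restrict a b c true  h rewrite ∧-identityʳ a | ∧-identityʳ b | ∧-identityʳ c = h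
ind-restrict a b c false _ rewrite ∧-zeroʳ a | ∧-zeroʳ b | ∧-zeroʳ c = refl

ind-exactly-one : ∀ c x y → (c ≡ true → y ≡ not x) → ind (c ∧ y) ℕ.+ ind (c ∧ x) ≡ ind (c ∧ c)
ind-exactly-one false x y _ = refl
ind-exactly-one true  x y h rewrite h refl with x
... | true  = refl
... | false = refl

-- For i < j exactly one of w₀σ and σ has an inversion at (i,j); w₀ inverts every pair.
inversion-split : ∀ {n} (σ : Vec (Fin n) n) → isPerm σ ≡ true → ∀ i j →
  ind (invPair (complement σ) i j) ℕ.+ ind (invPair σ i j) ≡ ind (invPair (w₀ n) i j)
inversion-split {n} σ isPermσ i j
  rewrite lookup-complement σ i | lookup-complement σ j | lookup-w₀ {n} i | lookup-w₀ {n} j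
        | opposite-<ᵇ (lookup σ j) (lookup σ i) | opposite-<ᵇ j i =
  ind-exactly-one (toℕ i <ᵇ toℕ j) _ _ values-flip
  where
  values-flip : (toℕ i <ᵇ toℕ j) ≡ true →
    (toℕ (lookup σ i) <ᵇ toℕ (lookup σ j)) ≡ not (toℕ (lookup σ j) <ᵇ toℕ (lookup σ i))
  values-flip i<j = <ᵇ-flip (toℕ (lookup σ j)) (toℕ (lookup σ i))
    (perm-injective σ isPermσ j i (<ᵇ⇒≡ᵇ-false (toℕ i) (toℕ j) i<j))

ℓ-complement : ∀ {n} (σ : Vec (Fin n) n) → isPerm σ ≡ true → ℓ (complement σ) ℕ.+ ℓ σ ≡ ℓ (w₀ n)
ℓ-complement {n} σ isPermσ = countPairs-additive n _ _ _ (inversion-split σ isPermσ)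

L-complement : ∀ {n} (σ : Vec (Fin n) n) → isPerm σ ≡ true → L (complement σ) ℕ.+ L σ ≡ L (w₀ n)
L-complement {n} σ isPermσ = countPairs-additive n
  (λ i j → invPair (complement σ) i j ∧ oppositeParity i j) (λ i j → invPair σ i j ∧ oppositeParity i j)
  (λ i j → invPair (w₀ n) i j ∧ oppositeParity i j)
  (λ i j → ind-restrict (invPair (complement σ) i j) (invPair σ i j) (invPair (w₀ n) i j)
                        (oppositeParity i j) (inversion-split σ isPermσ i j))
  where
  oppositeParity : Fin n → Fin n → Bool
  oppositeParity i j = not ((toℕ i % 2) ≡ᵇ (toℕ j % 2))

sum-cong : ∀ {A : Set} {f g : A → ℚ} → (∀ a → f a ≡ g a) → (xs : List A) → sumℚ f xs ≡ sumℚ g xs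
sum-cong f≗g []       = refl
sum-cong f≗g (x ∷ xs) = cong₂ _+_ (f≗g x) (sum-cong f≗g xs)

sum-filter : ∀ {A : Set} (f : A → ℚ) (p : A → Bool) (xs : List A) →
  sumℚ f (filterᵇ p xs) ≡ sumℚ (λ a → if p a then f a else 0ℚ) xs
sum-filter f p [] = refl
sum-filter f p (x ∷ xs) with p x
... | true  = cong (f x +_) (sum-filter f p xs)
... | false = trans (sum-filter f p xs) (sym (ℚP.+-identityˡ _))

sum-++ : ∀ {A : Set} (f : A → ℚ) (xs ys : List A) → sumℚ f (xs ++ ys) ≡ sumℚ f xs + sumℚ f ys
sum-++ f []       ys = sym (ℚP.+-identityˡ _)
sum-++ f (x ∷ xs) ys = trans (cong (f x +_) (sum-++ f xs ys)) (sym (ℚP.+-assoc (f x) _ _))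

sum-concatMap : ∀ {A B : Set} (f : B → ℚ) (g : A → List B) (xs : List A) →
  sumℚ f (concatMap g xs) ≡ sumℚ (λ a → sumℚ f (g a)) xs
sum-concatMap f g []       = refl
sum-concatMap f g (x ∷ xs) =
  trans (sum-++ f (g x) (concatMap g xs)) (cong (sumℚ f (g x) +_) (sum-concatMap f g xs))

sum-map : ∀ {A B : Set} (f : B → ℚ) (g : A → B) (xs : List A) →
  sumℚ f (List.map g xs) ≡ sumℚ (λ a → f (g a)) xs
sum-map f g []       = refl
sum-map f g (x ∷ xs) = cong (f (g x) +_) (sum-map f g xs)

sum-scale : ∀ {A : Set} (c : ℚ) (g : A → ℚ) (xs : List A) → c * sumℚ g xs ≡ sumℚ (λ a → c * g a) xs
sum-scale c g []       = ℚP.*-zeroʳ c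
sum-scale c g (x ∷ xs) = trans (ℚP.*-distribˡ-+ c (g x) _) (cong (c * g x +_) (sum-scale c g xs))

sumFin : ∀ n → (Fin n → ℚ) → ℚ
sumFin zero    g = 0ℚ
sumFin (suc n) g = g zero + sumFin n (λ i → g (suc i))

sum-tabulate : ∀ {A : Set} n (h : A → ℚ) (f : Fin n → A) →
  sumℚ h (List.tabulate f) ≡ sumFin n (λ i → h (f i))
sum-tabulate zero    h f = refl
sum-tabulate (suc n) h f = cong (h (f zero) +_) (sum-tabulate n h (λ i → f (suc i)))

sumFin-last : ∀ n (g : Fin (suc n) → ℚ) → sumFin (suc n) g ≡ sumFin n (λ i → g (inject₁ i)) + g (fromℕ n)
sumFin-last zero    g = trans (ℚP.+-identityʳ (g zero)) (sym (ℚP.+-identityˡ (g zero)))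
sumFin-last (suc n) g = begin
  g zero + sumFin (suc n) (λ i → g (suc i))
    ≡⟨ cong (g zero +_) (sumFin-last n (λ i → g (suc i))) ⟩
  g zero + (sumFin n (λ i → g (suc (inject₁ i))) + g (suc (fromℕ n)))
    ≡⟨ sym (ℚP.+-assoc (g zero) _ _) ⟩
  (g zero + sumFin n (λ i → g (suc (inject₁ i)))) + g (suc (fromℕ n)) ∎

sumFin-opposite : ∀ n (g : Fin n → ℚ) → sumFin n (λ i → g (opposite i)) ≡ sumFin n g
sumFin-opposite zero    g = refl
sumFin-opposite (suc n) g = begin
  g (fromℕ n) + sumFin n (λ i → g (inject₁ (opposite i)))
    ≡⟨ cong (g (fromℕ n) +_) (sumFin-opposite n (λ i → g (inject₁ i))) ⟩
  g (fromℕ n) + sumFin n (λ i → g (inject₁ i))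
    ≡⟨ ℚP.+-comm (g (fromℕ n)) _ ⟩
  sumFin n (λ i → g (inject₁ i)) + g (fromℕ n)
    ≡⟨ sym (sumFin-last n g) ⟩
  sumFin (suc n) g ∎

sum-allFin-opposite : ∀ n (h : Fin n → ℚ) → sumℚ (λ a → h (opposite a)) (allFin n) ≡ sumℚ h (allFin n)
sum-allFin-opposite n h =
  trans (sum-tabulate n _ (λ i → i)) (trans (sumFin-opposite n h) (sym (sum-tabulate n h (λ i → i))))

-- Complementation permutes the maps [k] → [n], so sums over all of them are invariant.
sum-allMaps-complement : ∀ k n (f : Vec (Fin n) k → ℚ) →
  sumℚ f (allMaps k n) ≡ sumℚ (λ v → f (complement v)) (allMaps k n)
sum-allMaps-complement zero    n f = refl
sum-allMaps-complement (suc k) n f = begin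
  sumℚ f (allMaps (suc k) n)
    ≡⟨ sum-by-head f ⟩
  sumℚ (λ v → sumℚ (λ a → f (a ∷ v)) (allFin n)) (allMaps k n)
    ≡⟨ sum-allMaps-complement k n (λ v → sumℚ (λ a → f (a ∷ v)) (allFin n)) ⟩
  sumℚ (λ v → sumℚ (λ a → f (a ∷ complement v)) (allFin n)) (allMaps k n)
    ≡⟨ sum-cong (λ v → sym (sum-allFin-opposite n (λ a → f (a ∷ complement v)))) (allMaps k n) ⟩
  sumℚ (λ v → sumℚ (λ a → f (complement (a ∷ v))) (allFin n)) (allMaps k n)
    ≡⟨ sym (sum-by-head (λ w → f (complement w))) ⟩
  sumℚ (λ v → f (complement v)) (allMaps (suc k) n) ∎
  where
  sum-by-head : (g : Vec (Fin n) (suc k) → ℚ) →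
    sumℚ g (allMaps (suc k) n) ≡ sumℚ (λ v → sumℚ (λ a → g (a ∷ v)) (allFin n)) (allMaps k n)
  sum-by-head g = trans (sum-concatMap g _ (allMaps k n))
                        (sum-cong (λ v → sum-map g (λ a → a ∷ v) (allFin n)) (allMaps k n))

^ℚ-is-^ : ∀ q k → q ^ℚ k ≡ q ^ k
^ℚ-is-^ q zero    = refl
^ℚ-is-^ q (suc k) = cong (q *_) (^ℚ-is-^ q k)

1^ : ∀ k → 1ℚ ^ k ≡ 1ℚ
1^ zero    = refl
1^ (suc k) = trans (ℚP.*-identityˡ _) (1^ k)

monomial-reflection : ∀ u y .{{_ : NonZero y}} → u * u ≡ 1ℚ → ∀ a b p q →
  (u ^ℚ b) * (y ^ℚ q) ≡ ((u ^ℚ (a ℕ.+ b)) * (y ^ℚ (p ℕ.+ q))) * ((u ^ℚ a) * ((1/ y) ^ℚ p))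
monomial-reflection u y u²≡1 a b p q
  rewrite ^ℚ-is-^ u b | ^ℚ-is-^ y q | ^ℚ-is-^ u (a ℕ.+ b) | ^ℚ-is-^ y (p ℕ.+ q)
        | ^ℚ-is-^ u a | ^ℚ-is-^ (1/ y) p = sym (begin
  ((u ^ (a ℕ.+ b)) * (y ^ (p ℕ.+ q))) * ((u ^ a) * ((1/ y) ^ p))
    ≡⟨ cong₂ (λ s t → (s * t) * ((u ^ a) * ((1/ y) ^ p))) (^-homo-* u a b) (^-homo-* y p q) ⟩
  (((u ^ a) * (u ^ b)) * ((y ^ p) * (y ^ q))) * ((u ^ a) * ((1/ y) ^ p))
    ≡⟨ regroup (u ^ a) (u ^ b) (y ^ p) (y ^ q) ((1/ y) ^ p) ⟩
  ((u ^ a) * (u ^ a)) * ((y ^ p) * ((1/ y) ^ p)) * ((u ^ b) * (y ^ q))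
    ≡⟨ cong₂ (λ s t → (s * t) * ((u ^ b) * (y ^ q))) (sym (^-distrib-* u u a)) (sym (^-distrib-* y (1/ y) p)) ⟩
  ((u * u) ^ a) * ((y * 1/ y) ^ p) * ((u ^ b) * (y ^ q))
    ≡⟨ cong₂ (λ s t → ((s ^ a) * (t ^ p)) * ((u ^ b) * (y ^ q))) u²≡1 (ℚP.*-inverseʳ y) ⟩
  (1ℚ ^ a) * (1ℚ ^ p) * ((u ^ b) * (y ^ q))
    ≡⟨ cong₂ (λ s t → (s * t) * ((u ^ b) * (y ^ q))) (1^ a) (1^ p) ⟩
  (1ℚ * 1ℚ) * ((u ^ b) * (y ^ q))
    ≡⟨ ℚP.*-identityˡ _ ⟩
  (u ^ b) * (y ^ q) ∎)
  where
  open +-*-Solver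
  regroup : ∀ s t v w z → ((s * t) * (v * w)) * (s * z) ≡ ((s * s) * (v * z)) * (t * w)
  regroup = solve 5 (λ s t v w z → ((s :* t) :* (v :* w)) :* (s :* z) := ((s :* s) :* (v :* z)) :* (t :* w)) refl

weight-complement : ∀ {n} (x : ℚ) .{{_ : NonZero x}} (σ : Vec (Fin n) n) → isPerm σ ≡ true →
  weight x σ ≡ ((- 1ℚ) ^ℚ ℓ (w₀ n)) * (x ^ℚ L (w₀ n)) * weight (1/ x) (complement σ)
weight-complement {n} x σ isPermσ = begin
  weight x σ
    ≡⟨ monomial-reflection (- 1ℚ) x refl (ℓ (complement σ)) (ℓ σ) (L (complement σ)) (L σ) ⟩
  ((- 1ℚ) ^ℚ (ℓ (complement σ) ℕ.+ ℓ σ)) * (x ^ℚ (L (complement σ) ℕ.+ L σ)) * weight (1/ x) (complement σ)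
    ≡⟨ cong₂ (λ s t → ((- 1ℚ) ^ℚ s) * (x ^ℚ t) * weight (1/ x) (complement σ))
             (ℓ-complement σ isPermσ) (L-complement σ isPermσ) ⟩
  ((- 1ℚ) ^ℚ ℓ (w₀ n)) * (x ^ℚ L (w₀ n)) * weight (1/ x) (complement σ) ∎

restrictedWeight : ∀ {m} → Subset m → Subset m → ℚ → Vec (Fin (suc m)) (suc m) → ℚ
restrictedWeight I J y σ = if isPerm σ then (if inDIJ I J σ then weight y σ else 0ℚ) else 0ℚ

sumD-as-total : ∀ m (I J : Subset m) y → sumD m I J y ≡ sumℚ (restrictedWeight I J y) (allMaps (suc m) (suc m))
sumD-as-total m I J y = trans (sum-filter (weight y) (inDIJ I J) (Sym (suc m)))
                              (sum-filter _ isPerm (allMaps (suc m) (suc m)))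

restrictedWeight-complement : ∀ {m} (I J : Subset m) (x : ℚ) .{{_ : NonZero x}} σ →
  restrictedWeight I J x σ
    ≡ ((- 1ℚ) ^ℚ ℓ (w₀ (suc m))) * (x ^ℚ L (w₀ (suc m))) * restrictedWeight J I (1/ x) (complement σ)
restrictedWeight-complement {m} I J x σ rewrite isPerm-complement σ with isPerm σ in isPermσ
... | false = sym (ℚP.*-zeroʳ (((- 1ℚ) ^ℚ ℓ (w₀ (suc m))) * (x ^ℚ L (w₀ (suc m)))))
... | true rewrite inDIJ-complement I J σ isPermσ with inDIJ I J σ
...   | false = sym (ℚP.*-zeroʳ (((- 1ℚ) ^ℚ ℓ (w₀ (suc m))) * (x ^ℚ L (w₀ (suc m)))))
...   | true  = weight-complement x σ isPermσ

proposition3p7 : (m : ℕ) (I J : Subset m) → I ∩ J ≡ ⊥ →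
    (x : ℚ) .{{_ : NonZero x}} →
    sumD m I J x ≡ ((- 1ℚ) ^ℚ ℓ (w₀ (suc m))) * (x ^ℚ L (w₀ (suc m))) * sumD m J I (1/ x)
proposition3p7 m I J _ x = begin
  sumD m I J x
    ≡⟨ sumD-as-total m I J x ⟩
  sumℚ (restrictedWeight I J x) (allMaps n n)
    ≡⟨ sum-cong (restrictedWeight-complement I J x) (allMaps n n) ⟩
  sumℚ (λ σ → c * restrictedWeight J I (1/ x) (complement σ)) (allMaps n n)
    ≡⟨ sym (sum-allMaps-complement n n (λ σ → c * restrictedWeight J I (1/ x) σ)) ⟩
  sumℚ (λ σ → c * restrictedWeight J I (1/ x) σ) (allMaps n n)
    ≡⟨ sym (sum-scale c (restrictedWeight J I (1/ x)) (allMaps n n)) ⟩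
  c * sumℚ (restrictedWeight J I (1/ x)) (allMaps n n)
    ≡⟨ cong (c *_) (sym (sumD-as-total m J I (1/ x))) ⟩
  c * sumD m J I (1/ x) ∎
  where
  n = suc m
  c = ((- 1ℚ) ^ℚ ℓ (w₀ n)) * (x ^ℚ L (w₀ n))
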